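{- For every integer $r\geq0$ we have $Q_r\mid Q_{2r+1}$ and $P_r\mid Q_{2r}$ in $\mathbb{Z}[x]$.
   Context: Fibonacci product polynomials: for $n\geq1$, $P_n(x)$ is the characteristic polynomial $\det(xI-M)$ of the $n\times n$ tridiagonal matrix with all sub- and superdiagonal entries $1$ and diagonal $(2,3,\dots,3)$, and $Q_n(x)$ that of the $n\times n$ tridiagonal matrix with sub- and superdiagonal entries $1$ and all diagonal entries $3$; $P_0=Q_0=1$. -}

module Defs where

open import Data.Nat as ℕ using (ℕ; zero; suc; ∣_-_∣; _≡ᵇ_)
open import Data.Integer as ℤ using (ℤ; +_; -_)
open import Data.List using (List; []; _∷_)
open import Data.Fin using (Fin; zero; suc; toℕ; punchIn)
open import Data.Bool using (if_then_else_)
open import Data.Product using (Σ)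
open import Relation.Binary.PropositionalEquality using (_≡_)

-- Polynomials in ℤ[x] as coefficient lists, lowest degree first.
-- Trailing zeros are allowed; equality is coefficientwise (see _≈ₚ_).
Poly : Set
Poly = List ℤ

coeff : Poly → ℕ → ℤ
coeff []       _       = + 0
coeff (a ∷ p)  zero    = a
coeff (a ∷ p)  (suc i) = coeff p i

_≈ₚ_ : Poly → Poly → Set
p ≈ₚ q = ∀ i → coeff p i ≡ coeff q i

infixl 6 _+ₚ_ _-ₚ_
infixl 7 _*ₚ_

_+ₚ_ : Poly → Poly → Poly
[]      +ₚ q       = q
(a ∷ p) +ₚ []      = a ∷ p
(a ∷ p) +ₚ (b ∷ q) = (a ℤ.+ b) ∷ (p +ₚ q)

scale : ℤ → Poly → Poly
scale c []      = []
scale c (a ∷ p) = (c ℤ.* a) ∷ scale c p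

negₚ : Poly → Poly
negₚ = scale (- (+ 1))

_-ₚ_ : Poly → Poly → Poly
p -ₚ q = p +ₚ negₚ q

_*ₚ_ : Poly → Poly → Poly
[]      *ₚ q = []
(a ∷ p) *ₚ q = scale a q +ₚ (+ 0 ∷ (p *ₚ q))

constₚ : ℤ → Poly
constₚ c = c ∷ []

0ₚ 1ₚ Xₚ : Poly
0ₚ = []
1ₚ = constₚ (+ 1)
Xₚ = + 0 ∷ + 1 ∷ []

_∣ₚ_ : Poly → Poly → Set
a ∣ₚ b = Σ Poly (λ c → (a *ₚ c) ≈ₚ b)

Mat : Set → ℕ → Set
Mat A n = Fin n → Fin n → A

altSum : ∀ n → (Fin n → Poly) → Poly
altSum zero    f = 0ₚ
altSum (suc n) f = f zero -ₚ altSum n (λ j → f (suc j))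

det : ∀ n → Mat Poly n → Poly
det zero    A = 1ₚ
det (suc n) A = altSum (suc n) (λ j → A zero j *ₚ det n (λ i k → A (suc i) (punchIn j k)))

charPoly : ∀ n → Mat ℤ n → Poly
charPoly n M = det n (λ i j → (if toℕ i ≡ᵇ toℕ j then Xₚ else 0ₚ) -ₚ constₚ (M i j))

tridiag : ∀ n → (Fin n → ℤ) → Mat ℤ n
tridiag n d i j =
  if toℕ i ≡ᵇ toℕ j then d i
  else if ∣ toℕ i - toℕ j ∣ ≡ᵇ 1 then + 1 else + 0

diagP : ∀ n → Fin n → ℤ
diagP n i = if toℕ i ≡ᵇ 0 then + 2 else + 3

diagQ : ∀ n → Fin n → ℤ
diagQ n i = + 3

-- P_n, Q_n (for n = 0 the empty determinant gives 1, matching P_0 = Q_0 = 1).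
P : ℕ → Poly
P n = charPoly n (tridiag n (diagP n))

Q : ℕ → Poly
Q n = charPoly n (tridiag n (diagQ n))

module Submission where

-- Expanding the tridiagonal determinants along their first row gives
-- Q (n + 2) = (x - 3) Q (n + 1) - Q n and P (n + 1) = Q (n + 1) + Q n.  Hence Q n = U (n + 1)
-- and P n = U (n + 1) + U n for the Lucas sequence U 0 = 0, U 1 = 1,
-- U (k + 2) = (x - 3) U (k + 1) - U k.  Its addition formula
-- U (m + n + 1) = U (m + 1) U (n + 1) - U m U n factors
-- Q (2r + 1) = U (r + 1) (U (r + 2) - U r) and
-- Q (2r) = U (r + 1)² - U r² = (U (r + 1) + U r) (U (r + 1) - U r).

open import Data.Nat as ℕ using (ℕ; zero; suc)
import Data.Nat.Properties as ℕ
open import Function using (_∘_)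
import Relation.Binary.PropositionalEquality as ≡
open import Algebra.Bundles using (CommutativeRing)

-- Lucas sequences in a commutative ring

module LucasSequence {c ℓ} (R : CommutativeRing c ℓ) (y : CommutativeRing.Carrier R) where

  open CommutativeRing R
  open import Algebra.Properties.Ring ring using (x[y-z]≈xy-xz; [y-z]x≈yx-zx; -0#≈0#; -‿+-comm)
  open import Algebra.Properties.CommutativeSemigroup +-commutativeSemigroup using (xy∙z≈xz∙y)
  open import Algebra.Properties.CommutativeSemigroup *-commutativeSemigroup using (x∙yz≈yx∙z)
  open import Relation.Binary.Reasoning.Setoid setoid

  U : ℕ → Carrier
  U zero          = 0#
  U (suc zero)    = 1#
  U (suc (suc n)) = y * U (suc n) - U n

  U-addition : ∀ m n → U (suc (m ℕ.+ n)) ≈ U (suc m) * U (suc n) - U m * U n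
  U-addition zero n = sym (begin
    1# * U (suc n) - 0# * U n  ≈⟨ +-cong (*-identityˡ _) (-‿cong (zeroˡ _)) ⟩
    U (suc n) - 0#             ≈⟨ +-congˡ -0#≈0# ⟩
    U (suc n) + 0#             ≈⟨ +-identityʳ _ ⟩
    U (suc n)                  ∎)
  U-addition (suc m) n = begin
    U (suc (suc m ℕ.+ n))                                   ≡⟨ ≡.cong (U ∘ suc) (ℕ.+-suc m n) ⟨
    U (suc (m ℕ.+ suc n))                                   ≈⟨ U-addition m (suc n) ⟩
    U (suc m) * (y * U (suc n) - U n) - U m * U (suc n)     ≈⟨ regroup (U (suc m)) (U m) (U (suc n)) (U n) ⟩
    (y * U (suc m) - U m) * U (suc n) - U (suc m) * U n     ∎
    where
    regroup : ∀ a b c d → a * (y * c - d) - b * c ≈ (y * a - b) * c - a * d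
    regroup a b c d = begin
      a * (y * c - d) - b * c       ≈⟨ +-congʳ (x[y-z]≈xy-xz a (y * c) d) ⟩
      a * (y * c) - a * d - b * c   ≈⟨ +-congʳ (+-congʳ (x∙yz≈yx∙z a y c)) ⟩
      y * a * c - a * d - b * c     ≈⟨ xy∙z≈xz∙y _ _ _ ⟩
      y * a * c - b * c - a * d     ≈⟨ +-congʳ ([y-z]x≈yx-zx c (y * a) b) ⟨
      (y * a - b) * c - a * d       ∎

  [x+y][x-y]≈x*x-y*y : ∀ a b → (a + b) * (a - b) ≈ a * a - b * b
  [x+y][x-y]≈x*x-y*y a b = begin
    (a + b) * (a - b)                       ≈⟨ x[y-z]≈xy-xz (a + b) a b ⟩
    (a + b) * a - (a + b) * b               ≈⟨ +-cong (distribʳ a a b) (-‿cong (distribʳ b a b)) ⟩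
    (a * a + b * a) - (a * b + b * b)       ≈⟨ +-congʳ (+-congˡ (*-comm b a)) ⟩
    (a * a + a * b) - (a * b + b * b)       ≈⟨ +-congˡ (-‿+-comm (a * b) (b * b)) ⟨
    (a * a + a * b) + (- (a * b) - b * b)   ≈⟨ +-assoc (a * a) (a * b) _ ⟩
    a * a + (a * b + (- (a * b) - b * b))   ≈⟨ +-congˡ (+-assoc (a * b) _ _) ⟨
    a * a + ((a * b - a * b) - b * b)       ≈⟨ +-congˡ (+-congʳ (-‿inverseʳ (a * b))) ⟩
    a * a + (0# - b * b)                    ≈⟨ +-congˡ (+-identityˡ _) ⟩
    a * a - b * b                           ∎

  U[2+2r]≈U[1+r][U[2+r]-U[r]] : ∀ r → U (suc (suc (2 ℕ.* r))) ≈ U (suc r) * (U (suc (suc r)) - U r)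
  U[2+2r]≈U[1+r][U[2+r]-U[r]] r = begin
    U (suc (suc (2 ℕ.* r)))                            ≡⟨ ≡.cong U (2+2r≡1+[r+[1+r]] r) ⟩
    U (suc (r ℕ.+ suc r))                              ≈⟨ U-addition r (suc r) ⟩
    U (suc r) * U (suc (suc r)) - U r * U (suc r)      ≈⟨ +-congˡ (-‿cong (*-comm (U r) _)) ⟩
    U (suc r) * U (suc (suc r)) - U (suc r) * U r      ≈⟨ x[y-z]≈xy-xz (U (suc r)) _ _ ⟨
    U (suc r) * (U (suc (suc r)) - U r)                ∎
    where
    2+2r≡1+[r+[1+r]] : ∀ r → suc (suc (2 ℕ.* r)) ≡.≡ suc (r ℕ.+ suc r)
    2+2r≡1+[r+[1+r]] r = ≡.cong suc (≡.trans (≡.cong (suc ∘ (r ℕ.+_)) (ℕ.+-identityʳ r)) (≡.sym (ℕ.+-suc r r)))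

  U[1+2r]≈[U[1+r]+U[r]][U[1+r]-U[r]] : ∀ r → U (suc (2 ℕ.* r)) ≈ (U (suc r) + U r) * (U (suc r) - U r)
  U[1+2r]≈[U[1+r]+U[r]][U[1+r]-U[r]] r = begin
    U (suc (2 ℕ.* r))                    ≡⟨ ≡.cong (U ∘ suc ∘ (r ℕ.+_)) (ℕ.+-identityʳ r) ⟩
    U (suc (r ℕ.+ r))                    ≈⟨ U-addition r r ⟩
    U (suc r) * U (suc r) - U r * U r    ≈⟨ [x+y][x-y]≈x*x-y*y (U (suc r)) (U r) ⟨
    (U (suc r) + U r) * (U (suc r) - U r) ∎

-- The commutative ring ℤ[x]

open import Data.Integer as ℤ using (ℤ; +_)
import Data.Integer.Properties as ℤ
open import Data.List using ([]; _∷_)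
open import Data.Fin using (Fin; zero; suc; toℕ; punchIn)
open import Data.Bool using (if_then_else_)
open import Data.Product using (_×_; _,_)
open import Level using (0ℓ)
open import Relation.Binary.PropositionalEquality
  using (_≡_; refl; sym; trans; cong; cong₂; module ≡-Reasoning)
open import Relation.Binary.Structures using (IsEquivalence)
open import Algebra.Properties.CommutativeSemigroup ℤ.+-commutativeSemigroup
  using (interchange)

open import Defs

infix 4 _≈_

-- _≈ₚ_ wrapped in a record, so that the two polynomials can be inferred from a proof.
record _≈_ (p q : Poly) : Set where
  constructor mk
  field get : p ≈ₚ q
open _≈_

≈-refl : ∀ {p} → p ≈ p
≈-refl = mk λ _ → refl

≈-sym : ∀ {p q} → p ≈ q → q ≈ p
≈-sym (mk h) = mk (sym ∘ h)

≈-trans : ∀ {p q r} → p ≈ q → q ≈ r → p ≈ r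
≈-trans (mk h) (mk g) = mk λ i → trans (h i) (g i)

≈-isEquivalence : IsEquivalence _≈_
≈-isEquivalence = record { refl = ≈-refl ; sym = ≈-sym ; trans = ≈-trans }

∷-cong : ∀ {a b p q} → a ≡ b → p ≈ q → a ∷ p ≈ b ∷ q
∷-cong a≡b (mk h) = mk λ { zero → a≡b ; (suc i) → h i }

coeff-+ₚ : ∀ p q i → coeff (p +ₚ q) i ≡ coeff p i ℤ.+ coeff q i
coeff-+ₚ []      q       i       = sym (ℤ.+-identityˡ _)
coeff-+ₚ (a ∷ p) []      i       = sym (ℤ.+-identityʳ _)
coeff-+ₚ (a ∷ p) (b ∷ q) zero    = refl
coeff-+ₚ (a ∷ p) (b ∷ q) (suc i) = coeff-+ₚ p q i

coeff-scale : ∀ c p i → coeff (scale c p) i ≡ c ℤ.* coeff p i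
coeff-scale c []      i       = sym (ℤ.*-zeroʳ c)
coeff-scale c (a ∷ p) zero    = refl
coeff-scale c (a ∷ p) (suc i) = coeff-scale c p i

coeff-negₚ : ∀ p i → coeff (negₚ p) i ≡ ℤ.- coeff p i
coeff-negₚ p i = trans (coeff-scale _ p i) (ℤ.-1*i≡-i _)

+ₚ-cong : ∀ {p p′ q q′} → p ≈ p′ → q ≈ q′ → p +ₚ q ≈ p′ +ₚ q′
+ₚ-cong {p} {p′} {q} {q′} (mk h) (mk g) = mk λ i → begin
  coeff (p +ₚ q) i           ≡⟨ coeff-+ₚ p q i ⟩
  coeff p i ℤ.+ coeff q i    ≡⟨ cong₂ ℤ._+_ (h i) (g i) ⟩
  coeff p′ i ℤ.+ coeff q′ i  ≡⟨ coeff-+ₚ p′ q′ i ⟨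
  coeff (p′ +ₚ q′) i         ∎
  where open ≡-Reasoning

scale-cong : ∀ {c d p q} → c ≡ d → p ≈ q → scale c p ≈ scale d q
scale-cong {c} {d} {p} {q} c≡d (mk h) = mk λ i → begin
  coeff (scale c p) i   ≡⟨ coeff-scale c p i ⟩
  c ℤ.* coeff p i       ≡⟨ cong₂ ℤ._*_ c≡d (h i) ⟩
  d ℤ.* coeff q i       ≡⟨ coeff-scale d q i ⟨
  coeff (scale d q) i   ∎
  where open ≡-Reasoning

negₚ-cong : ∀ {p q} → p ≈ q → negₚ p ≈ negₚ q
negₚ-cong = scale-cong refl

+ₚ-assoc : ∀ p q r → (p +ₚ q) +ₚ r ≈ p +ₚ (q +ₚ r)
+ₚ-assoc p q r = mk λ i → begin
  coeff ((p +ₚ q) +ₚ r) i                   ≡⟨ coeff-+ₚ (p +ₚ q) r i ⟩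
  coeff (p +ₚ q) i ℤ.+ coeff r i            ≡⟨ cong (ℤ._+ coeff r i) (coeff-+ₚ p q i) ⟩
  coeff p i ℤ.+ coeff q i ℤ.+ coeff r i     ≡⟨ ℤ.+-assoc (coeff p i) _ _ ⟩
  coeff p i ℤ.+ (coeff q i ℤ.+ coeff r i)   ≡⟨ cong (ℤ._+_ (coeff p i)) (coeff-+ₚ q r i) ⟨
  coeff p i ℤ.+ coeff (q +ₚ r) i            ≡⟨ coeff-+ₚ p (q +ₚ r) i ⟨
  coeff (p +ₚ (q +ₚ r)) i                   ∎
  where open ≡-Reasoning

+ₚ-comm : ∀ p q → p +ₚ q ≈ q +ₚ p
+ₚ-comm p q = mk λ i → trans (coeff-+ₚ p q i) (trans (ℤ.+-comm (coeff p i) _) (sym (coeff-+ₚ q p i)))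

+ₚ-identityˡ : ∀ p → 0ₚ +ₚ p ≈ p
+ₚ-identityˡ p = ≈-refl

+ₚ-identityʳ : ∀ p → p +ₚ 0ₚ ≈ p
+ₚ-identityʳ p = mk λ i → trans (coeff-+ₚ p [] i) (ℤ.+-identityʳ _)

+ₚ-inverseʳ : ∀ p → p +ₚ negₚ p ≈ 0ₚ
+ₚ-inverseʳ p = mk λ i → trans (coeff-+ₚ p (negₚ p) i)
  (trans (cong (ℤ._+_ (coeff p i)) (coeff-negₚ p i)) (ℤ.+-inverseʳ (coeff p i)))

+ₚ-inverseˡ : ∀ p → negₚ p +ₚ p ≈ 0ₚ
+ₚ-inverseˡ p = ≈-trans (+ₚ-comm (negₚ p) p) (+ₚ-inverseʳ p)

+ₚ-interchange : ∀ w x y z → (w +ₚ x) +ₚ (y +ₚ z) ≈ (w +ₚ y) +ₚ (x +ₚ z)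
+ₚ-interchange w x y z = mk λ i → begin
  coeff ((w +ₚ x) +ₚ (y +ₚ z)) i                          ≡⟨ expand w x y z i ⟩
  coeff w i ℤ.+ coeff x i ℤ.+ (coeff y i ℤ.+ coeff z i)   ≡⟨ interchange (coeff w i) _ _ _ ⟩
  coeff w i ℤ.+ coeff y i ℤ.+ (coeff x i ℤ.+ coeff z i)   ≡⟨ expand w y x z i ⟨
  coeff ((w +ₚ y) +ₚ (x +ₚ z)) i                          ∎
  where
  open ≡-Reasoning
  expand : ∀ a b c d i → coeff ((a +ₚ b) +ₚ (c +ₚ d)) i
                       ≡ coeff a i ℤ.+ coeff b i ℤ.+ (coeff c i ℤ.+ coeff d i)
  expand a b c d i = trans (coeff-+ₚ (a +ₚ b) (c +ₚ d) i)
    (cong₂ ℤ._+_ (coeff-+ₚ a b i) (coeff-+ₚ c d i))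

+ₚ-comm-left : ∀ x y z → x +ₚ (y +ₚ z) ≈ y +ₚ (x +ₚ z)
+ₚ-comm-left x y z =
  ≈-trans (≈-sym (+ₚ-assoc x y z)) (≈-trans (+ₚ-cong (+ₚ-comm x y) ≈-refl) (+ₚ-assoc y x z))

scale-identity : ∀ p → scale (+ 1) p ≈ p
scale-identity p = mk λ i → trans (coeff-scale (+ 1) p i) (ℤ.*-identityˡ _)

scale-zero : ∀ p → scale (+ 0) p ≈ 0ₚ
scale-zero p = mk (coeff-scale (+ 0) p)

scale-assoc : ∀ c a p → scale (c ℤ.* a) p ≈ scale c (scale a p)
scale-assoc c a p = mk λ i → begin
  coeff (scale (c ℤ.* a) p) i   ≡⟨ coeff-scale (c ℤ.* a) p i ⟩
  c ℤ.* a ℤ.* coeff p i         ≡⟨ ℤ.*-assoc c a (coeff p i) ⟩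
  c ℤ.* (a ℤ.* coeff p i)       ≡⟨ cong (c ℤ.*_) (coeff-scale a p i) ⟨
  c ℤ.* coeff (scale a p) i     ≡⟨ coeff-scale c (scale a p) i ⟨
  coeff (scale c (scale a p)) i ∎
  where open ≡-Reasoning

scale-distribˡ : ∀ c p q → scale c (p +ₚ q) ≈ scale c p +ₚ scale c q
scale-distribˡ c p q = mk λ i → begin
  coeff (scale c (p +ₚ q)) i                  ≡⟨ coeff-scale c (p +ₚ q) i ⟩
  c ℤ.* coeff (p +ₚ q) i                      ≡⟨ cong (c ℤ.*_) (coeff-+ₚ p q i) ⟩
  c ℤ.* (coeff p i ℤ.+ coeff q i)             ≡⟨ ℤ.*-distribˡ-+ c (coeff p i) _ ⟩
  c ℤ.* coeff p i ℤ.+ c ℤ.* coeff q i         ≡⟨ cong₂ ℤ._+_ (coeff-scale c p i) (coeff-scale c q i) ⟨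
  coeff (scale c p) i ℤ.+ coeff (scale c q) i ≡⟨ coeff-+ₚ (scale c p) (scale c q) i ⟨
  coeff (scale c p +ₚ scale c q) i            ∎
  where open ≡-Reasoning

scale-distribʳ : ∀ a b p → scale (a ℤ.+ b) p ≈ scale a p +ₚ scale b p
scale-distribʳ a b p = mk λ i → begin
  coeff (scale (a ℤ.+ b) p) i                 ≡⟨ coeff-scale (a ℤ.+ b) p i ⟩
  (a ℤ.+ b) ℤ.* coeff p i                     ≡⟨ ℤ.*-distribʳ-+ (coeff p i) a b ⟩
  a ℤ.* coeff p i ℤ.+ b ℤ.* coeff p i         ≡⟨ cong₂ ℤ._+_ (coeff-scale a p i) (coeff-scale b p i) ⟨
  coeff (scale a p) i ℤ.+ coeff (scale b p) i ≡⟨ coeff-+ₚ (scale a p) (scale b p) i ⟨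
  coeff (scale a p +ₚ scale b p) i            ∎
  where open ≡-Reasoning

constₚ0≈0ₚ : constₚ (+ 0) ≈ 0ₚ
constₚ0≈0ₚ = mk λ { zero → refl ; (suc i) → refl }

p≈0⇒p*q≈0 : ∀ {p} q → p ≈ 0ₚ → p *ₚ q ≈ 0ₚ
p≈0⇒p*q≈0 {[]}    q _          = ≈-refl
p≈0⇒p*q≈0 {a ∷ p} q (mk a∷p≈0) =
  +ₚ-cong (≈-trans (scale-cong (a∷p≈0 zero) ≈-refl) (scale-zero q))
          (≈-trans (∷-cong refl (p≈0⇒p*q≈0 {p} q (mk (a∷p≈0 ∘ suc)))) constₚ0≈0ₚ)

*ₚ-congʳ : ∀ {p p′} q → p ≈ p′ → p *ₚ q ≈ p′ *ₚ q
*ₚ-congʳ {[]}    {[]}      q _    = ≈-refl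
*ₚ-congʳ {[]}    {b ∷ p′}  q p≈p′ = ≈-sym (p≈0⇒p*q≈0 q (≈-sym p≈p′))
*ₚ-congʳ {a ∷ p} {[]}      q p≈p′ = p≈0⇒p*q≈0 q p≈p′
*ₚ-congʳ {a ∷ p} {b ∷ p′}  q (mk h) =
  +ₚ-cong (scale-cong (h zero) ≈-refl) (∷-cong refl (*ₚ-congʳ {p} {p′} q (mk (h ∘ suc))))

*ₚ-congˡ : ∀ p {q q′} → q ≈ q′ → p *ₚ q ≈ p *ₚ q′
*ₚ-congˡ []      q≈q′ = ≈-refl
*ₚ-congˡ (a ∷ p) q≈q′ = +ₚ-cong (scale-cong refl q≈q′) (∷-cong refl (*ₚ-congˡ p q≈q′))

*ₚ-zeroʳ : ∀ p → p *ₚ 0ₚ ≈ 0ₚ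
*ₚ-zeroʳ []      = ≈-refl
*ₚ-zeroʳ (a ∷ p) = ≈-trans (∷-cong refl (*ₚ-zeroʳ p)) constₚ0≈0ₚ

*ₚ-∷ : ∀ p b q → p *ₚ (b ∷ q) ≈ scale b p +ₚ (+ 0 ∷ p *ₚ q)
*ₚ-∷ []      b q = ≈-sym constₚ0≈0ₚ
*ₚ-∷ (a ∷ p) b q = ∷-cong (cong (ℤ._+ + 0) (ℤ.*-comm a b))
  (≈-trans (+ₚ-cong ≈-refl (*ₚ-∷ p b q)) (+ₚ-comm-left (scale a q) (scale b p) (+ 0 ∷ p *ₚ q)))

*ₚ-comm : ∀ p q → p *ₚ q ≈ q *ₚ p
*ₚ-comm []      q = ≈-sym (*ₚ-zeroʳ q)
*ₚ-comm (a ∷ p) q = ≈-trans (+ₚ-cong ≈-refl (∷-cong refl (*ₚ-comm p q))) (≈-sym (*ₚ-∷ q a p))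

*ₚ-distribʳ : ∀ r p q → (p +ₚ q) *ₚ r ≈ p *ₚ r +ₚ q *ₚ r
*ₚ-distribʳ r []      q       = ≈-refl
*ₚ-distribʳ r (a ∷ p) []      = ≈-sym (+ₚ-identityʳ _)
*ₚ-distribʳ r (a ∷ p) (b ∷ q) =
  ≈-trans (+ₚ-cong (scale-distribʳ a b r) (∷-cong refl (*ₚ-distribʳ r p q)))
          (+ₚ-interchange (scale a r) (scale b r) (+ 0 ∷ p *ₚ r) (+ 0 ∷ q *ₚ r))

*ₚ-distribˡ : ∀ p q r → p *ₚ (q +ₚ r) ≈ p *ₚ q +ₚ p *ₚ r
*ₚ-distribˡ p q r =
  ≈-trans (*ₚ-comm p (q +ₚ r)) (≈-trans (*ₚ-distribʳ p q r) (+ₚ-cong (*ₚ-comm q p) (*ₚ-comm r p)))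

scale-*ₚ : ∀ c p q → scale c p *ₚ q ≈ scale c (p *ₚ q)
scale-*ₚ c []      q = ≈-refl
scale-*ₚ c (a ∷ p) q = ≈-trans
  (+ₚ-cong (scale-assoc c a q) (∷-cong refl (scale-*ₚ c p q)))
  (≈-sym (≈-trans (scale-distribˡ c (scale a q) (+ 0 ∷ p *ₚ q))
                  (+ₚ-cong ≈-refl (∷-cong (ℤ.*-zeroʳ c) ≈-refl))))

*ₚ-assoc : ∀ p q r → (p *ₚ q) *ₚ r ≈ p *ₚ (q *ₚ r)
*ₚ-assoc []      q r = ≈-refl
*ₚ-assoc (a ∷ p) q r = ≈-trans (*ₚ-distribʳ r (scale a q) (+ 0 ∷ p *ₚ q))
  (+ₚ-cong (scale-*ₚ a q r)
           (≈-trans (+ₚ-cong (scale-zero r) ≈-refl) (∷-cong refl (*ₚ-assoc p q r))))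

*ₚ-identityˡ : ∀ p → 1ₚ *ₚ p ≈ p
*ₚ-identityˡ p = ≈-trans (+ₚ-cong (scale-identity p) constₚ0≈0ₚ) (+ₚ-identityʳ p)

*ₚ-identityʳ : ∀ p → p *ₚ 1ₚ ≈ p
*ₚ-identityʳ p = ≈-trans (*ₚ-comm p 1ₚ) (*ₚ-identityˡ p)

ℤ[x] : CommutativeRing 0ℓ 0ℓ
ℤ[x] = record
  { Carrier = Poly ; _≈_ = _≈_ ; _+_ = _+ₚ_ ; _*_ = _*ₚ_ ; -_ = negₚ ; 0# = 0ₚ ; 1# = 1ₚ
  ; isCommutativeRing = record
    { isRing = record
      { +-isAbelianGroup = record
        { isGroup = record
          { isMonoid = record
            { isSemigroup = record
              { isMagma = record { isEquivalence = ≈-isEquivalence ; ∙-cong = +ₚ-cong }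
              ; assoc = +ₚ-assoc }
            ; identity = +ₚ-identityˡ , +ₚ-identityʳ }
          ; inverse = +ₚ-inverseˡ , +ₚ-inverseʳ
          ; ⁻¹-cong = negₚ-cong }
        ; comm = +ₚ-comm }
      ; *-cong = λ {p} {p′} {q} p≈p′ q≈q′ → ≈-trans (*ₚ-congʳ q p≈p′) (*ₚ-congˡ p′ q≈q′)
      ; *-assoc = *ₚ-assoc
      ; *-identity = *ₚ-identityˡ , *ₚ-identityʳ
      ; distrib = *ₚ-distribˡ , *ₚ-distribʳ }
    ; *-comm = *ₚ-comm } }

-- Determinants of tridiagonal matrices

open CommutativeRing ℤ[x] using (setoid; +-congˡ; -‿cong)
open import Algebra.Properties.Ring (CommutativeRing.ring ℤ[x]) using (-1*x≈-x; -‿involutive)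
open import Algebra.Properties.CommutativeSemigroup (CommutativeRing.+-commutativeSemigroup ℤ[x])
  using (xy∙z≈xz∙y)
open import Relation.Binary.Reasoning.Setoid setoid

minor : ∀ {n} → Mat Poly (suc n) → Fin (suc n) → Mat Poly n
minor A j i k = A (suc i) (punchIn j k)

altSum-≈0 : ∀ n (f : Fin n → Poly) → (∀ j → f j ≈ 0ₚ) → altSum n f ≈ 0ₚ
altSum-≈0 zero    f f≈0 = ≈-refl
altSum-≈0 (suc n) f f≈0 = +ₚ-cong (f≈0 zero) (negₚ-cong (altSum-≈0 n (f ∘ suc) (f≈0 ∘ suc)))

mutual
  det-zero-column : ∀ n (A : Mat Poly (suc n)) → (∀ i → A i zero ≈ 0ₚ) → det (suc n) A ≈ 0ₚ
  det-zero-column n A col≈0 = altSum-≈0 (suc n) _ (cofactor-zero-column n A col≈0)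

  cofactor-zero-column : ∀ n (A : Mat Poly (suc n)) → (∀ i → A i zero ≈ 0ₚ) →
                         ∀ j → A zero j *ₚ det n (minor A j) ≈ 0ₚ
  cofactor-zero-column n       A col≈0 zero    = p≈0⇒p*q≈0 _ (col≈0 zero)
  cofactor-zero-column (suc n) A col≈0 (suc j) =
    ≈-trans (*ₚ-congˡ (A zero (suc j)) (det-zero-column n (minor A (suc j)) (col≈0 ∘ suc)))
            (*ₚ-zeroʳ (A zero (suc j)))

det-laplace-two-entries : ∀ n (A : Mat Poly (suc (suc n))) → (∀ j → A zero (suc (suc j)) ≈ 0ₚ) →
  det (suc (suc n)) A ≈ A zero zero *ₚ det (suc n) (minor A zero)
                       -ₚ A zero (suc zero) *ₚ det (suc n) (minor A (suc zero))
det-laplace-two-entries n A row≈0 = +-congˡ (-‿cong (begin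
  cofactor (suc zero) -ₚ altSum n (λ j → cofactor (suc (suc j)))
    ≈⟨ +-congˡ (-‿cong (altSum-≈0 n _ λ j → p≈0⇒p*q≈0 _ (row≈0 j))) ⟩
  cofactor (suc zero) +ₚ 0ₚ
    ≈⟨ +ₚ-identityʳ _ ⟩
  cofactor (suc zero) ∎))
  where
  cofactor : Fin (suc (suc n)) → Poly
  cofactor j = A zero j *ₚ det (suc n) (minor A j)

charMatrix : ∀ n → Mat ℤ n → Mat Poly n
charMatrix n M i j = (if toℕ i ℕ.≡ᵇ toℕ j then Xₚ else 0ₚ) -ₚ constₚ (M i j)

-- Off the tridiagonal band the entries of charMatrix reduce to constₚ (+ 0).
det-tridiag-minor₁ : ∀ n (d : Fin (suc (suc n)) → ℤ) →
  det (suc n) (minor (charMatrix (suc (suc n)) (tridiag (suc (suc n)) d)) (suc zero))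
    ≈ negₚ (charPoly n (tridiag n (λ i → d (suc (suc i)))))
det-tridiag-minor₁ zero    d = ≈-refl
det-tridiag-minor₁ (suc n) d = begin
  det (suc (suc n)) B
    ≈⟨ det-laplace-two-entries n B (λ _ → constₚ0≈0ₚ) ⟩
  negₚ 1ₚ *ₚ T -ₚ negₚ 1ₚ *ₚ det (suc n) (minor B (suc zero))
    ≈⟨ +-congˡ (-‿cong (≈-trans (*ₚ-congˡ (negₚ 1ₚ) (det-zero-column n (minor B (suc zero)) (λ _ → constₚ0≈0ₚ)))
                                (*ₚ-zeroʳ (negₚ 1ₚ)))) ⟩
  negₚ 1ₚ *ₚ T +ₚ 0ₚ
    ≈⟨ +ₚ-identityʳ _ ⟩
  negₚ 1ₚ *ₚ T
    ≈⟨ -1*x≈-x T ⟩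
  negₚ T ∎
  where
  B = minor (charMatrix (suc (suc (suc n))) (tridiag (suc (suc (suc n))) d)) (suc zero)
  T = charPoly (suc n) (tridiag (suc n) (λ i → d (suc (suc i))))

charPoly-tridiag-recurrence : ∀ n (d : Fin (suc (suc n)) → ℤ) →
  charPoly (suc (suc n)) (tridiag (suc (suc n)) d)
    ≈ (Xₚ -ₚ constₚ (d zero)) *ₚ charPoly (suc n) (tridiag (suc n) (λ i → d (suc i)))
      -ₚ charPoly n (tridiag n (λ i → d (suc (suc i))))
charPoly-tridiag-recurrence n d = begin
  det (suc (suc n)) M
    ≈⟨ det-laplace-two-entries n M (λ _ → constₚ0≈0ₚ) ⟩
  (Xₚ -ₚ constₚ (d zero)) *ₚ T₁ -ₚ negₚ 1ₚ *ₚ det (suc n) (minor M (suc zero))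
    ≈⟨ +-congˡ (-‿cong (*ₚ-congˡ (negₚ 1ₚ) (det-tridiag-minor₁ n d))) ⟩
  (Xₚ -ₚ constₚ (d zero)) *ₚ T₁ -ₚ negₚ 1ₚ *ₚ negₚ T₀
    ≈⟨ +-congˡ (-‿cong (≈-trans (-1*x≈-x (negₚ T₀)) (-‿involutive T₀))) ⟩
  (Xₚ -ₚ constₚ (d zero)) *ₚ T₁ -ₚ T₀ ∎
  where
  M = charMatrix (suc (suc n)) (tridiag (suc (suc n)) d)
  T₁ = charPoly (suc n) (tridiag (suc n) (λ i → d (suc i)))
  T₀ = charPoly n (tridiag n (λ i → d (suc (suc i))))

x-3 : Poly
x-3 = Xₚ -ₚ constₚ (+ 3)

open LucasSequence ℤ[x] x-3
  using (U; U[2+2r]≈U[1+r][U[2+r]-U[r]]; U[1+2r]≈[U[1+r]+U[r]][U[1+r]-U[r]])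

Q-recurrence : ∀ n → Q (suc (suc n)) ≈ x-3 *ₚ Q (suc n) -ₚ Q n
Q-recurrence n = charPoly-tridiag-recurrence n (diagQ (suc (suc n)))

-- The recurrence applies to P with Xₚ -ₚ constₚ (+ 2), which is the list x-3 +ₚ 1ₚ, and
-- with the shifted diagonal of P, which is that of Q.
P≈Q+Q : ∀ n → P (suc n) ≈ Q (suc n) +ₚ Q n
P≈Q+Q zero    = ≈-refl
P≈Q+Q (suc n) = begin
  P (suc (suc n))
    ≈⟨ charPoly-tridiag-recurrence n (diagP (suc (suc n))) ⟩
  (x-3 +ₚ 1ₚ) *ₚ Q (suc n) -ₚ Q n
    ≈⟨ +ₚ-cong (≈-trans (*ₚ-distribʳ (Q (suc n)) x-3 1ₚ)
                        (+ₚ-cong (≈-refl {x-3 *ₚ Q (suc n)}) (*ₚ-identityˡ (Q (suc n)))))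
               ≈-refl ⟩
  x-3 *ₚ Q (suc n) +ₚ Q (suc n) -ₚ Q n
    ≈⟨ xy∙z≈xz∙y (x-3 *ₚ Q (suc n)) (Q (suc n)) (negₚ (Q n)) ⟩
  x-3 *ₚ Q (suc n) -ₚ Q n +ₚ Q (suc n)
    ≈⟨ +ₚ-cong (Q-recurrence n) ≈-refl ⟨
  Q (suc (suc n)) +ₚ Q (suc n) ∎

Q≈U : ∀ n → Q n ≈ U (suc n)
Q≈U zero          = ≈-refl
Q≈U (suc zero)    = ≈-refl
Q≈U (suc (suc n)) = ≈-trans (Q-recurrence n) (+ₚ-cong (*ₚ-congˡ x-3 (Q≈U (suc n))) (negₚ-cong (Q≈U n)))

P≈U+U : ∀ n → P n ≈ U (suc n) +ₚ U n
P≈U+U zero    = ≈-sym (+ₚ-identityʳ 1ₚ)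
P≈U+U (suc n) = ≈-trans (P≈Q+Q n) (+ₚ-cong (Q≈U (suc n)) (Q≈U n))

open import Data.Nat using (_*_)

proposition4p15 : ∀ (r : ℕ) → (Q r ∣ₚ Q (suc (2 * r))) × (P r ∣ₚ Q (2 * r))
proposition4p15 r = (U (suc (suc r)) -ₚ U r , get Q-factor) , (U (suc r) -ₚ U r , get P-factor)
  where
  Q-factor : Q r *ₚ (U (suc (suc r)) -ₚ U r) ≈ Q (suc (2 * r))
  Q-factor = begin
    Q r *ₚ (U (suc (suc r)) -ₚ U r)        ≈⟨ *ₚ-congʳ _ (Q≈U r) ⟩
    U (suc r) *ₚ (U (suc (suc r)) -ₚ U r)  ≈⟨ U[2+2r]≈U[1+r][U[2+r]-U[r]] r ⟨
    U (suc (suc (2 * r)))                  ≈⟨ Q≈U (suc (2 * r)) ⟨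
    Q (suc (2 * r))                        ∎
  P-factor : P r *ₚ (U (suc r) -ₚ U r) ≈ Q (2 * r)
  P-factor = begin
    P r *ₚ (U (suc r) -ₚ U r)                    ≈⟨ *ₚ-congʳ _ (P≈U+U r) ⟩
    (U (suc r) +ₚ U r) *ₚ (U (suc r) -ₚ U r)     ≈⟨ U[1+2r]≈[U[1+r]+U[r]][U[1+r]-U[r]] r ⟨
    U (suc (2 * r))                              ≈⟨ Q≈U (2 * r) ⟨
    Q (2 * r)                                    ∎
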